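{- Let $w=w_1\cdots w_n$ be a word of distinct positive integers avoiding $31245,32145,31254,32154$. Let the left-to-right maxima of $w$ be at positions $l_1<\dots<l_s$ and the right-to-left maxima at positions $r_1<\dots<r_t$, so $1=l_1$, $l_s=r_1$, $r_t=n$. Suppose $s>1$, $t>1$, $l_s>s$ and $w_{l_{s-1}}<w_{r_2}$. Then one of the following holds: (I-1) $l_s=l_{s-1}+1$; (I-2) $l_s=l_{s-1}+2$ and $w_j<w_{l_{s-1}}$ for all $j$ with $l_s<j<r_2$; (I-3) $l_s=l_{s-1}+2$ and there is an integer $k$ with $l_s<k<r_2$ such that $w_j>w_{l_{s-1}}$ for $l_s<j\le k$ and $w_j<w_{l_{s-1}}$ for $k<j<r_2$.
   Context: A word avoids a pattern $P$ if it has no subsequence order-isomorphic to $P$. A left-to-right (resp. right-to-left) maximum of $w$ is an entry larger than all entries to its left (resp. right). -}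

module Defs where

open import Data.Nat using (ℕ; _<_)
open import Data.Fin using (Fin) renaming (_<_ to _<ᶠ_)
open import Data.Vec using (Vec; lookup; _∷_; [])
open import Data.Product using (Σ; _×_; ∃)
open import Relation.Nullary using (¬_)
open import Function.Bundles using (_⇔_)

-- A word of length n is a function  w : Fin n → ℕ  (position i : Fin n is the
-- 1-based position  toℕ i + 1  of the paper).

StrictlyIncreasing : {k n : ℕ} → (Fin k → Fin n) → Set
StrictlyIncreasing f = ∀ a b → a <ᶠ b → f a <ᶠ f b

Contains : {k n : ℕ} → (p : Fin k → ℕ) → (w : Fin n → ℕ) → Set
Contains {k} {n} p w =
  Σ (Fin k → Fin n) λ f → StrictlyIncreasing f ×
    (∀ a b → (p a < p b) ⇔ (w (f a) < w (f b)))

Avoids : {k n : ℕ} → (p : Fin k → ℕ) → (w : Fin n → ℕ) → Set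
Avoids p w = ¬ Contains p w

pat : Vec ℕ 5 → Fin 5 → ℕ
pat v = lookup v

p31245 p32145 p31254 p32154 : Fin 5 → ℕ
p31245 = pat (3 ∷ 1 ∷ 2 ∷ 4 ∷ 5 ∷ [])
p32145 = pat (3 ∷ 2 ∷ 1 ∷ 4 ∷ 5 ∷ [])
p31254 = pat (3 ∷ 1 ∷ 2 ∷ 5 ∷ 4 ∷ [])
p32154 = pat (3 ∷ 2 ∷ 1 ∷ 5 ∷ 4 ∷ [])

IsLRMax : {n : ℕ} → (Fin n → ℕ) → Fin n → Set
IsLRMax w i = ∀ j → j <ᶠ i → w j < w i

IsRLMax : {n : ℕ} → (Fin n → ℕ) → Fin n → Set
IsRLMax w i = ∀ j → i <ᶠ j → w j < w i

Enumerates : {m n : ℕ} → (Fin m → Fin n) → (Fin n → Set) → Set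
Enumerates {m} e P = StrictlyIncreasing e × (∀ i → P i ⇔ ∃ λ (a : Fin m) → e a ≡ i)
  where open import Relation.Binary.PropositionalEquality using (_≡_)

-- Put L = l_{s-1}, M = l_s and R = r_2, so that L < M < R, w_L < w_M and w_L < w_R.  The four
-- forbidden patterns are precisely the order types of positions i₀ < i₁ < i₂ < i₃ < i₄ with
-- w_{i₁}, w_{i₂} < w_{i₀} < w_{i₃}, w_{i₄}.  Every entry strictly between L and M is below w_L,
-- since the first one above w_L would be another left-to-right maximum.  Two such entries followed
-- by M and R would form a forbidden configuration, so M ≤ L + 2.  When M = L + 2, an entry w_x < w_L
-- followed by an entry w_y > w_L with M < x < y < R gives the forbidden configuration L, L+1, x, y, R;
-- hence the entries of (M, R) above w_L form an initial segment of it, which is (I-2) or (I-3).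
module Submission where

open import Defs
open import Data.Nat using (ℕ; suc; _<_; _+_)
open import Data.Fin using (Fin; toℕ; fromℕ; inject₁; zero; suc) renaming (_<_ to _<ᶠ_; _≤_ to _≤ᶠ_)
open import Data.Product using (Σ; _×_; ∃)
open import Data.Sum using (_⊎_)
open import Function.Definitions using (Injective)
open import Relation.Binary.PropositionalEquality using (_≡_)

open import Data.Nat using (_≤_; _<?_; s≤s; z≤n)
open import Data.Nat.Properties
  using (<-trans; <-irrefl; <-asym; <-cmp; ≤-reflexive; ≤-pred; <⇒≱; ≰⇒>; ≮⇒≥; <-≤-trans; ≤-<-trans;
         m≤n⇒m<n∨m≡n; ≤∧≢⇒<)
open import Data.Fin using (fromℕ<; pred; Fin′; inject; #_)
import Data.Fin.Properties as Fin
import Data.Fin.Induction as Fin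
open import Data.Vec using (Vec; lookup; _∷_; [])
open import Data.Product using (_,_; proj₁; proj₂)
open import Data.Sum using (inj₁; inj₂)
open import Data.Empty using (⊥; ⊥-elim)
open import Data.Unit using (tt)
open import Level using (_⊔_)
open import Function using (_∘_)
open import Function.Bundles using (_⇔_; mk⇔; Equivalence)
open import Induction.WellFounded using (Acc; acc)
open import Relation.Binary.Definitions using (Tri; tri<; tri≈; tri>)
open import Relation.Binary.PropositionalEquality using (refl; cong; sym; trans; subst)
open import Relation.Nullary using (¬_)
open import Relation.Nullary.Decidable using (Dec; True; toWitness; _→-dec_; _⊎-dec_; _×-dec_)
open import Relation.Unary using (Pred; Decidable)

Increasing : ∀ {k} → (Fin k → ℕ) → Set
Increasing u = ∀ a b → a <ᶠ b → u a < u b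

increasing-reflects-< : ∀ {k} {u : Fin k → ℕ} → Increasing u → ∀ {a b} → u a < u b → a <ᶠ b
increasing-reflects-< u↑ {a} {b} ua<ub with Fin.<-cmp a b
... | tri< a<b _ _ = a<b
... | tri≈ _ refl _ = ⊥-elim (<-irrefl refl ua<ub)
... | tri> _ _ b<a = ⊥-elim (<-asym ua<ub (u↑ b a b<a))

increasing-of-steps : ∀ {k} (u : Fin (suc k) → ℕ) → (∀ i → u (inject₁ i) < u (suc i)) → Increasing u
increasing-of-steps u step zero (suc zero) _ = step zero
increasing-of-steps {suc k} u step zero (suc (suc j)) _ =
  <-trans (step zero) (increasing-of-steps (λ i → u (suc i)) (λ i → step (suc i)) zero (suc j) (s≤s z≤n))
increasing-of-steps {suc k} u step (suc i) (suc j) (s≤s i<j) =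
  increasing-of-steps (λ i → u (suc i)) (λ i → step (suc i)) i j i<j

contains-by-sorting : ∀ {k n} (p : Fin k → ℕ) (w : Fin n → ℕ) (f : Fin k → Fin n) (σ : Fin k → Fin k) →
  (∀ a → ∃ λ i → σ i ≡ a) → Increasing (λ i → p (σ i)) →
  StrictlyIncreasing f → Increasing (λ i → w (f (σ i))) → Contains p w
contains-by-sorting p w f σ σ-onto pσ↑ f↑ wfσ↑ = f , f↑ , order-iso
  where
  order-iso : ∀ a b → (p a < p b) ⇔ (w (f a) < w (f b))
  order-iso a b with σ-onto a | σ-onto b
  ... | i , refl | j , refl =
    mk⇔ (λ lt → wfσ↑ i j (increasing-reflects-< pσ↑ lt)) (λ lt → pσ↑ i j (increasing-reflects-< wfσ↑ lt))

Avoids3xxyy : ∀ {n} → (Fin n → ℕ) → Set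
Avoids3xxyy w = ∀ {i₀ i₁ i₂ i₃ i₄} → i₀ <ᶠ i₁ → i₁ <ᶠ i₂ → i₂ <ᶠ i₃ → i₃ <ᶠ i₄ →
  w i₁ < w i₀ → w i₂ < w i₀ → w i₀ < w i₃ → w i₀ < w i₄ → ⊥

increasing₅ : (u : Fin 5 → ℕ) → u (# 0) < u (# 1) → u (# 1) < u (# 2) → u (# 2) < u (# 3) → u (# 3) < u (# 4) →
  Increasing u
increasing₅ u s₀ s₁ s₂ s₃ = increasing-of-steps u λ where
  zero → s₀
  (suc zero) → s₁
  (suc (suc zero)) → s₂
  (suc (suc (suc zero))) → s₃

onto? : ∀ {k} (σ : Fin k → Fin k) → Dec (∀ a → ∃ λ i → σ i ≡ a)
onto? σ = Fin.all? λ a → Fin.any? λ i → σ i Fin.≟ a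

increasing? : ∀ {k} (u : Fin k → ℕ) → Dec (Increasing u)
increasing? u = Fin.all? λ a → Fin.all? λ b → (a Fin.<? b) →-dec (u a <? u b)

avoids3xxyy : ∀ {n} {w : Fin n → ℕ} → Injective _≡_ _≡_ w →
  Avoids p31245 w → Avoids p32145 w → Avoids p31254 w → Avoids p32154 w → Avoids3xxyy w
avoids3xxyy {n} {w} inj av₁ av₂ av₃ av₄ {i₀} {i₁} {i₂} {i₃} {i₄} o₀₁ o₁₂ o₂₃ o₃₄ w₁<w₀ w₂<w₀ w₀<w₃ w₀<w₄ =
  by-cases (<-cmp (w i₁) (w i₂)) (<-cmp (w i₃) (w i₄))
  where
  f : Fin 5 → Fin n
  f = lookup (i₀ ∷ i₁ ∷ i₂ ∷ i₃ ∷ i₄ ∷ [])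

  -- σ lists the five positions in increasing order of value.
  sorted-by : ∀ {p} (σ : Vec (Fin 5) 5) → True (onto? (lookup σ)) → True (increasing? (λ i → p (lookup σ i))) →
    Increasing (λ i → w (f (lookup σ i))) → Contains p w
  sorted-by σ onto pσ↑ wfσ↑ =
    contains-by-sorting _ w f (lookup σ) (toWitness onto) (toWitness pσ↑) (increasing₅ _ o₀₁ o₁₂ o₂₃ o₃₄) wfσ↑

  by-cases : Tri (w i₁ < w i₂) (w i₁ ≡ w i₂) (w i₂ < w i₁) → Tri (w i₃ < w i₄) (w i₃ ≡ w i₄) (w i₄ < w i₃) → ⊥
  by-cases (tri< w₁<w₂ _ _) (tri< w₃<w₄ _ _) =
    av₁ (sorted-by (# 1 ∷ # 2 ∷ # 0 ∷ # 3 ∷ # 4 ∷ []) tt tt (increasing₅ _ w₁<w₂ w₂<w₀ w₀<w₃ w₃<w₄))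
  by-cases (tri> _ _ w₂<w₁) (tri< w₃<w₄ _ _) =
    av₂ (sorted-by (# 2 ∷ # 1 ∷ # 0 ∷ # 3 ∷ # 4 ∷ []) tt tt (increasing₅ _ w₂<w₁ w₁<w₀ w₀<w₃ w₃<w₄))
  by-cases (tri< w₁<w₂ _ _) (tri> _ _ w₄<w₃) =
    av₃ (sorted-by (# 1 ∷ # 2 ∷ # 0 ∷ # 4 ∷ # 3 ∷ []) tt tt (increasing₅ _ w₁<w₂ w₂<w₀ w₀<w₄ w₄<w₃))
  by-cases (tri> _ _ w₂<w₁) (tri> _ _ w₄<w₃) =
    av₄ (sorted-by (# 2 ∷ # 1 ∷ # 0 ∷ # 4 ∷ # 3 ∷ []) tt tt (increasing₅ _ w₂<w₁ w₁<w₀ w₀<w₄ w₄<w₃))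
  by-cases (tri≈ _ w₁≡w₂ _) _ = <-irrefl (cong toℕ (inj w₁≡w₂)) o₁₂
  by-cases _ (tri≈ _ w₃≡w₄ _) = <-irrefl (cong toℕ (inj w₃≡w₄)) o₃₄

suc-toℕ-pred : ∀ {n} {m f : Fin n} → m <ᶠ f → suc (toℕ (pred f)) ≡ toℕ f
suc-toℕ-pred {f = suc g} _ = cong suc (Fin.toℕ-inject₁ g)

Threshold : ∀ {n a b} → Pred (Fin n) a → Pred (Fin n) b → Fin n → Fin n → Set (a ⊔ b)
Threshold {n} A B m r =
  Σ (Fin n) λ k → m ≤ᶠ k × k <ᶠ r × (∀ j → m <ᶠ j → j ≤ᶠ k → A j) × (∀ j → k <ᶠ j → j <ᶠ r → B j)

module _ {n a b} {A : Pred (Fin n) a} {B : Pred (Fin n) b} (A? : Decidable A) where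

  threshold : ∀ {m r} → m <ᶠ r →
    (∀ {j} → m <ᶠ j → j <ᶠ r → ¬ A j → B j) →
    (∀ {i j} → m <ᶠ i → i <ᶠ j → j <ᶠ r → B i → ¬ A j) →
    Threshold A B m r
  threshold {m} {r} m<r B-of-¬A no-A-after-B = from-first-failure (Fin.¬∀⟶∃¬-smallest n P P? λ ∀P → ¬Pr (∀P r))
    where
    P : Pred (Fin n) a
    P j = j ≤ᶠ m ⊎ (j <ᶠ r × A j)
    P? : Decidable P
    P? j = (j Fin.≤? m) ⊎-dec ((j Fin.<? r) ×-dec A? j)
    ¬Pr : ¬ P r
    ¬Pr (inj₁ r≤m) = <⇒≱ m<r r≤m
    ¬Pr (inj₂ (r<r , _)) = <-irrefl refl r<r

    -- k is the predecessor of the first f > m with f = r or ¬ A f.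
    from-first-failure : (∃ λ f → ¬ P f × ((j : Fin′ f) → P (inject j))) → Threshold A B m r
    from-first-failure (f , ¬Pf , P-inject) = pred f , m≤k , k<r , A-upto-k , B-after-k
      where
      P-before : ∀ j → j <ᶠ f → P j
      P-before j j<f = subst P (Fin.toℕ-injective (trans (Fin.toℕ-inject _) (Fin.toℕ-fromℕ< j<f))) (P-inject (fromℕ< j<f))
      m<f : m <ᶠ f
      m<f = ≰⇒> (¬Pf ∘ inj₁)
      f≤r : f ≤ᶠ r
      f≤r = ≮⇒≥ λ r<f → ¬Pr (P-before r r<f)
      ¬Af : f <ᶠ r → ¬ A f
      ¬Af f<r Af = ¬Pf (inj₂ (f<r , Af))
      k≡f-1 : suc (toℕ (pred f)) ≡ toℕ f
      k≡f-1 = suc-toℕ-pred m<f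
      m≤k : m ≤ᶠ pred f
      m≤k = ≤-pred (subst (suc (toℕ m) ≤_) (sym k≡f-1) m<f)
      k<r : pred f <ᶠ r
      k<r = subst (_≤ toℕ r) (sym k≡f-1) f≤r
      A-upto-k : ∀ j → m <ᶠ j → j ≤ᶠ pred f → A j
      A-upto-k j m<j j≤k with P-before j (subst (suc (toℕ j) ≤_) k≡f-1 (s≤s j≤k))
      ... | inj₁ j≤m = ⊥-elim (<⇒≱ m<j j≤m)
      ... | inj₂ (_ , Aj) = Aj
      B-after-k : ∀ j → pred f <ᶠ j → j <ᶠ r → B j
      B-after-k j k<j j<r = B-of-¬A (<-≤-trans m<f f≤j) j<r ¬Aj
        where
        f≤j : f ≤ᶠ j
        f≤j = subst (_≤ toℕ j) k≡f-1 k<j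
        ¬Aj : ¬ A j
        ¬Aj with m≤n⇒m<n∨m≡n f≤j
        ... | inj₁ f<j = no-A-after-B m<f f<j j<r (B-of-¬A m<f (<-trans f<j j<r) (¬Af (<-trans f<j j<r)))
        ... | inj₂ f≡j = subst (λ i → ¬ A i) (Fin.toℕ-injective f≡j) (¬Af (subst (_< toℕ r) (sym f≡j) j<r))

module _ {m n} {e : Fin (suc m) → Fin n} {P : Fin n → Set} (enum : Enumerates e P) where

  enumerated : ∀ c → P (e c)
  enumerated c = Equivalence.from (proj₂ enum (e c)) (c , refl)

  ¬between-consecutive : ∀ c {j} → e (inject₁ c) <ᶠ j → j <ᶠ e (suc c) → ¬ P j
  ¬between-consecutive c c<j j<c+1 Pj with Equivalence.to (proj₂ enum _) Pj
  ... | d , refl = <⇒≱ c<d (≤-pred d<c+1)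
    where
    c<d : toℕ c < toℕ d
    c<d = subst (_< toℕ d) (Fin.toℕ-inject₁ c) (increasing-reflects-< (proj₁ enum) c<j)
    d<c+1 : toℕ d < suc (toℕ c)
    d<c+1 = increasing-reflects-< (proj₁ enum) j<c+1

LRMax≤RLMax : ∀ {n} {w : Fin n → ℕ} {i j} → IsLRMax w i → IsRLMax w j → i ≤ᶠ j
LRMax≤RLMax lr rl = ≮⇒≥ λ j<i → <-asym (lr _ j<i) (rl _ j<i)

below-LRMax : ∀ {n} {w : Fin n → ℕ} {L M : Fin n} → Injective _≡_ _≡_ w → IsLRMax w L →
  (∀ {j : Fin n} → L <ᶠ j → j <ᶠ M → ¬ IsLRMax w j) →
  ∀ {j : Fin n} → L <ᶠ j → j <ᶠ M → w j < w L
below-LRMax {w = w} {L} {M} inj lrL no-LRMax {j} = go (Fin.<-wellFounded j)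
  where
  go : ∀ {j} → Acc _<ᶠ_ j → L <ᶠ j → j <ᶠ M → w j < w L
  go {j} (acc rec) L<j j<M with <-cmp (w j) (w L)
  ... | tri< wj<wL _ _ = wj<wL
  ... | tri≈ _ wj≡wL _ = ⊥-elim (Fin.<-irrefl (sym (inj wj≡wL)) L<j)
  ... | tri> _ _ wL<wj = ⊥-elim (no-LRMax L<j j<M lrj)
    where
    lrj : IsLRMax w j
    lrj i i<j with Fin.<-cmp i L
    ... | tri< i<L _ _ = <-trans (lrL i i<L) wL<wj
    ... | tri≈ _ refl _ = wL<wj
    ... | tri> _ _ L<i = <-trans (go (rec i<j) L<i (<-trans i<j j<M)) wL<wj

-- (I-1) ⊎ (I-2) ⊎ (I-3), with L = l_{s-1}, M = l_s and R = r_2.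
Shape : ∀ {n} → (Fin n → ℕ) → Fin n → Fin n → Fin n → Set
Shape {n} w L M R =
  (toℕ M ≡ 1 + toℕ L)
  ⊎ ((toℕ M ≡ 2 + toℕ L) × (∀ j → M <ᶠ j → j <ᶠ R → w j < w L))
  ⊎ ((toℕ M ≡ 2 + toℕ L)
     × Σ (Fin n) λ k → (M <ᶠ k) × (k <ᶠ R)
       × (∀ j → M <ᶠ j → j ≤ᶠ k → w L < w j)
       × (∀ j → k <ᶠ j → j <ᶠ R → w j < w L))

index-after : ∀ {n} {i j : Fin n} → suc (toℕ i) < toℕ j → ∃ λ k → toℕ k ≡ suc (toℕ i) × k <ᶠ j
index-after {n} {i} {j} i+1<j = fromℕ< k<n , Fin.toℕ-fromℕ< k<n , subst (_< toℕ j) (sym (Fin.toℕ-fromℕ< k<n)) i+1<j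
  where
  k<n : suc (toℕ i) < n
  k<n = <-trans i+1<j (Fin.toℕ<n j)

module _ {n} {w : Fin n → ℕ} (inj : Injective _≡_ _≡_ w) (avoid : Avoids3xxyy w) {L M R : Fin n}
         (L<M : L <ᶠ M) (M<R : M <ᶠ R) (wL<wM : w L < w M) (wL<wR : w L < w R)
         (below : ∀ {j} → L <ᶠ j → j <ᶠ M → w j < w L) where

  no-two-between : ∀ {i j} → L <ᶠ i → i <ᶠ j → j <ᶠ M → ⊥
  no-two-between L<i i<j j<M =
    avoid L<i i<j j<M M<R (below L<i (<-trans i<j j<M)) (below (<-trans L<i i<j) j<M) wL<wM wL<wR

  no-rise-after-dip : ∀ {i} → L <ᶠ i → i <ᶠ M → ∀ {x y} → M <ᶠ x → x <ᶠ y → y <ᶠ R → w x < w L → ¬ (w L < w y)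
  no-rise-after-dip L<i i<M M<x x<y y<R wx<wL wL<wy =
    avoid L<i (<-trans i<M M<x) x<y y<R (below L<i i<M) wx<wL wL<wy wL<wR

  ¬above⇒below : ∀ {j} → M <ᶠ j → j <ᶠ R → ¬ (w L < w j) → w j < w L
  ¬above⇒below M<j _ ¬wL<wj = ≤∧≢⇒< (≮⇒≥ ¬wL<wj) λ wj≡wL → Fin.<-irrefl (sym (inj wj≡wL)) (<-trans L<M M<j)

  shape-if-gap>1 : (∃ λ i → toℕ i ≡ suc (toℕ L) × i <ᶠ M) → Shape w L M R
  shape-if-gap>1 (i , i≡L+1 , i<M) =
    split-at (threshold (λ j → w L <? w j) M<R ¬above⇒below (no-rise-after-dip L<i i<M))
    where
    L<i : L <ᶠ i
    L<i = ≤-reflexive (sym i≡L+1)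
    M≡L+2 : toℕ M ≡ 2 + toℕ L
    M≡L+2 with m≤n⇒m<n∨m≡n i<M
    ... | inj₁ i+1<M =
      let (j , j≡i+1 , j<M) = index-after i+1<M in ⊥-elim (no-two-between L<i (≤-reflexive (sym j≡i+1)) j<M)
    ... | inj₂ i+1≡M = trans (sym i+1≡M) (cong suc i≡L+1)
    split-at : Threshold (λ j → w L < w j) (λ j → w j < w L) M R → Shape w L M R
    split-at (k , M≤k , k<R , above , below-after) with m≤n⇒m<n∨m≡n M≤k
    ... | inj₁ M<k = inj₂ (inj₂ (M≡L+2 , k , M<k , k<R , above , below-after))
    ... | inj₂ M≡k = inj₂ (inj₁ (M≡L+2 , λ j M<j → below-after j (subst (_< toℕ j) M≡k M<j)))

  shape : Shape w L M R
  shape with m≤n⇒m<n∨m≡n L<M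
  ... | inj₁ L+1<M = shape-if-gap>1 (index-after L+1<M)
  ... | inj₂ L+1≡M = inj₁ (sym L+1≡M)

lemma3p1 : (n : ℕ) (w : Fin n → ℕ) →
    Injective _≡_ _≡_ w → (∀ i → 0 < w i) →
    Avoids p31245 w → Avoids p32145 w → Avoids p31254 w → Avoids p32154 w →
    -- s = suc (suc a) > 1 left-to-right maxima at l, t = suc (suc b) > 1 right-to-left maxima at r
    (a b : ℕ) (l : Fin (suc (suc a)) → Fin n) (r : Fin (suc (suc b)) → Fin n) →
    Enumerates l (IsLRMax w) → Enumerates r (IsRLMax w) →
    -- l_s > s  (1-based position of l_s is toℕ + 1)
    suc (suc a) < suc (toℕ (l (fromℕ (suc a)))) →
    -- w_{l_{s-1}} < w_{r_2}
    w (l (inject₁ (fromℕ a))) < w (r (suc zero)) →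
    (toℕ (l (fromℕ (suc a))) ≡ 1 + toℕ (l (inject₁ (fromℕ a))))
    ⊎ ((toℕ (l (fromℕ (suc a))) ≡ 2 + toℕ (l (inject₁ (fromℕ a))))
       × (∀ j → l (fromℕ (suc a)) <ᶠ j → j <ᶠ r (suc zero) →
            w j < w (l (inject₁ (fromℕ a)))))
    ⊎ ((toℕ (l (fromℕ (suc a))) ≡ 2 + toℕ (l (inject₁ (fromℕ a))))
       × Σ (Fin n) λ k → (l (fromℕ (suc a)) <ᶠ k) × (k <ᶠ r (suc zero))
         × (∀ j → l (fromℕ (suc a)) <ᶠ j → j ≤ᶠ k → w (l (inject₁ (fromℕ a))) < w j)
         × (∀ j → k <ᶠ j → j <ᶠ r (suc zero) → w j < w (l (inject₁ (fromℕ a)))))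
-- Neither positivity of the entries nor l_s > s is needed.
lemma3p1 n w inj _ av₁ av₂ av₃ av₄ a b l r l-enum r-enum _ wL<wR =
  shape inj (avoids3xxyy inj av₁ av₂ av₃ av₄) L<M M<R (lrM _ L<M) wL<wR
    (below-LRMax inj (enumerated l-enum (inject₁ (fromℕ a))) (¬between-consecutive l-enum (fromℕ a)))
  where
  lrM : IsLRMax w (l (fromℕ (suc a)))
  lrM = enumerated l-enum (fromℕ (suc a))
  L<M : l (inject₁ (fromℕ a)) <ᶠ l (fromℕ (suc a))
  L<M = proj₁ l-enum _ _ (Fin.≤̄⇒inject₁< Fin.≤-refl)
  M<R : l (fromℕ (suc a)) <ᶠ r (suc zero)
  M<R = ≤-<-trans (LRMax≤RLMax lrM (enumerated r-enum zero)) (proj₁ r-enum zero (suc zero) (s≤s z≤n))
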